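{- At any time during any sequence of operations on two-parent hollow heaps (as defined in the context), every full node has at most one parent and every hollow node has at most two parents. Moreover, once a node is hollow it never acquires a new parent.
   Context: Heaps. A heap stores a finite set of items, each with a key from a totally ordered universe, and supports: make-heap() (return an empty heap); find-min($h$) (return an item of minimum key in $h$, or null if $h$ is empty); insert($e,k,h$) (add item $e$, which is in no heap, with key $k$); delete-min($h$) (delete from non-empty $h$ the item that find-min($h$) returns); meld($h_1,h_2$) (return a heap containing all items of the item-disjoint heaps $h_1,h_2$); decrease-key($e,k,h$) (given an item $e$ in $h$ with key greater than $k$, change its key to $k$); delete($e,h$) (delete item $e$ from $h$). Heaps passed as arguments are destroyed; decrease-key and delete are given the location of $e$. Nodes. Nodes hold items: each node holds at most one item, and is full if it holds one and hollow otherwise; each item in a heap is held by exactly one node; a newly created node is full and a hollow node never becomes full again. Each node $u$ has a key $u.key$ (the current key of its item if $u$ is full; if $u$ is hollow, the key its item had just before leaving $u$) and a non-negative integer rank $u.rank$. A tree (or dag) of nodes with arcs from parent to child is heap-ordered if $v.key\le w.key$ for every arc $(v,w)$; a root is a node with no parent. For two full roots, link makes the one of larger key (ties broken arbitrarily) a child of the other; the new child is the loser and the other the winner. A ranked link is a link of two roots of equal rank and increases the winner's rank by one; an unranked link may be applied to any two full roots and changes no ranks. Two-parent hollow heap. It is either empty or a heap-ordered directed acyclic graph of nodes with one root, which is full; the root is the minimum node. make-heap returns an empty heap; find-min returns the item in the root; meld returns one heap if the other is empty, and otherwise does an unranked link of the two roots; insert($e,k,h$) creates a new full node of rank 0 holding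 $e$ with key $k$ and melds this one-node heap with $h$. decrease-key($e,k,h$), with $u$ the node holding $e$: if $u$ is the root one may simply set $u.key=k$; otherwise create a new node $v$, move $e$ from $u$ to $v$ (so $u$ becomes hollow), set $v.key=k$ and $v.rank=\max\{0,u.rank-2\}$, add the arc $(v,u)$ so that $u$ acquires $v$ as an additional parent (no children of $u$ are moved), and meld the one-node heap $v$ with the heap. delete($e,h$) removes $e$ from the node $u$ holding it, making $u$ hollow; if $u$ is not the root this completes the operation; otherwise, while some root is hollow, destroy such a root (removing its outgoing arcs, so that children left with no parent become roots); then do ranked links while two roots have equal rank; then do unranked links until one root remains. delete-min($h$) performs delete on the item in the root. -}

module Defs where

open import Level using (_⊔_)
open import Data.Nat using (ℕ; zero; suc; _∸_; _≟_; _≡ᵇ_)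
open import Data.Bool using (Bool; true; false; if_then_else_; not)
open import Data.Maybe using (Maybe; just; nothing; maybe)
open import Data.Product using (_×_; _,_; proj₁; proj₂; ∃)
open import Data.Sum using (_⊎_)
open import Data.List using (List; []; _∷_; _++_; filter; map; null)
open import Data.List.Membership.Propositional using (_∈_; _∉_)
open import Data.List.Relation.Binary.Permutation.Propositional using (_↭_)
open import Relation.Binary.Bundles using (TotalOrder)
open import Relation.Binary.PropositionalEquality using (_≡_; _≢_)
open import Relation.Nullary using (¬_)

-- Two-parent hollow heaps, modelled as one global state holding all
-- nodes of all heaps.  Nodes are named by natural numbers (fresh names
-- are allocated from a counter and never reused).  Arcs go from parent
-- to child.  Between operations, every heap is identified by its root
-- (a full node with no parent); an empty heap holds no nodes.
-- Items are not modelled separately: each full node holds exactly one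
-- item, and an item is addressed by (the location of) its node.

module HollowHeap {c ℓ₁ ℓ₂} (O : TotalOrder c ℓ₁ ℓ₂) where

  open TotalOrder O public using (_≈_) renaming (Carrier to Key; _≤_ to _≤ᵏ_)

  _<ᵏ_ : Key → Key → Set (ℓ₁ ⊔ ℓ₂)
  x <ᵏ y = x ≤ᵏ y × ¬ (x ≈ y)

  record NodeInfo : Set c where
    constructor node
    field
      full : Bool   -- true = full, false = hollow
      key  : Key
      rank : ℕ
  open NodeInfo public

  Arc : Set
  Arc = ℕ × ℕ     -- (parent , child)

  record State : Set c where
    constructor st
    field
      next  : ℕ                   -- next fresh node name
      nodes : ℕ → Maybe NodeInfo  -- nothing = node does not (or no longer) exist
      arcs  : List Arc
  open State public

  initial : State
  initial = st 0 (λ _ → nothing) []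

  parents : State → ℕ → List ℕ
  parents s u = map proj₁ (filter (λ a → proj₂ a ≟ u) (arcs s))

  children : State → ℕ → List ℕ
  children s u = map proj₂ (filter (λ a → proj₁ a ≟ u) (arcs s))

  IsRoot : State → ℕ → Set
  IsRoot s u = ∀ p → (p , u) ∉ arcs s

  data Reach (s : State) : ℕ → ℕ → Set where
    here  : ∀ {r} → Reach s r r
    there : ∀ {r x v} → (r , x) ∈ arcs s → Reach s x v → Reach s r v

  rankOf : State → ℕ → ℕ
  rankOf s u = maybe rank 0 (nodes s u)

  setNode : ℕ → Maybe NodeInfo → State → State
  setNode u m s = record s { nodes = λ w → if w ≡ᵇ u then m else nodes s w }

  addArc : Arc → State → State
  addArc a s = record s { arcs = a ∷ arcs s }

  create : Key → ℕ → State → State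
  create k r s = record (setNode (next s) (just (node true k r)) s) { next = suc (next s) }

  destroy : ℕ → State → State
  destroy x s = record (setNode x nothing s)
    { arcs = filter (λ a → ¬? (proj₁ a ≟ x)) (arcs s) }
    where open import Relation.Nullary.Decidable using (¬?)

  -- Links.  Link s w l s' : w wins, l loses (becomes a child of w).

  data UnrankedLink (s : State) (w l : ℕ) : State → Set (c ⊔ ℓ₂) where
    ulink : ∀ {kw rw kl rl} → w ≢ l →
            nodes s w ≡ just (node true kw rw) →
            nodes s l ≡ just (node true kl rl) →
            IsRoot s w → IsRoot s l → kw ≤ᵏ kl →
            UnrankedLink s w l (addArc (w , l) s)

  data RankedLink (s : State) (w l : ℕ) : State → Set (c ⊔ ℓ₂) where
    rlink : ∀ {kw kl r} → w ≢ l →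
            nodes s w ≡ just (node true kw r) →
            nodes s l ≡ just (node true kl r) →
            IsRoot s w → IsRoot s l → kw ≤ᵏ kl →
            RankedLink s w l (addArc (w , l) (setNode w (just (node true kw (suc r))) s))

  LinkEither : State → ℕ → ℕ → State → Set (c ⊔ ℓ₂)
  LinkEither s a b s' = UnrankedLink s a b s' ⊎ UnrankedLink s b a s'

  -- The clean-up after the root became hollow in delete.  The list R is
  -- the current set of roots of the pieces of the heap being processed.

  -- Phase 1: while some root is hollow, destroy such a root; children
  -- left with no parent become roots.
  data DestroyPhase : State → List ℕ → State → List ℕ → Set c where
    done    : ∀ {s R} → DestroyPhase s R s R
    destroy-step : ∀ {s R₁ R₂ x k r s' R'} →
            nodes s x ≡ just (node false k r) → IsRoot s x →
            DestroyPhase (destroy x s)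
              (R₁ ++ R₂ ++ filter (λ ch → null (parents (destroy x s) ch) Data.Bool.≟ true) (children s x))
              s' R' →
            DestroyPhase s (R₁ ++ x ∷ R₂) s' R'

  data RankedPhase : State → List ℕ → State → List ℕ → Set (c ⊔ ℓ₂) where
    done    : ∀ {s R} → RankedPhase s R s R
    rank-step : ∀ {s R w l R₀ s₁ s' R'} →
            R ↭ (w ∷ l ∷ R₀) → RankedLink s w l s₁ →
            RankedPhase s₁ (w ∷ R₀) s' R' →
            RankedPhase s R s' R'

  data UnrankedPhase : State → List ℕ → State → List ℕ → Set (c ⊔ ℓ₂) where
    done    : ∀ {s R} → UnrankedPhase s R s R
    unrank-step : ∀ {s R w l R₀ s₁ s' R'} →
            R ↭ (w ∷ l ∷ R₀) → UnrankedLink s w l s₁ →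
            UnrankedPhase s₁ (w ∷ R₀) s' R' →
            UnrankedPhase s R s' R'

  data AtMostOne {a} {A : Set a} : List A → Set a where
    zero-elems : AtMostOne []
    one-elem   : ∀ {x} → AtMostOne (x ∷ [])

  -- the whole clean-up, each phase run until its loop condition fails
  data Cleanup (s : State) (R : List ℕ) : State → Set (c ⊔ ℓ₁ ⊔ ℓ₂) where
    cleanup : ∀ {s₁ R₁ s₂ R₂ s₃ R₃} →
      DestroyPhase s R s₁ R₁ →
      (∀ x → x ∈ R₁ → ∃ λ k → ∃ λ r → nodes s₁ x ≡ just (node true k r)) →
      RankedPhase s₁ R₁ s₂ R₂ →
      (∀ w l R₀ → R₂ ↭ (w ∷ l ∷ R₀) → rankOf s₂ w ≢ rankOf s₂ l) →
      UnrankedPhase s₂ R₂ s₃ R₃ →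
      AtMostOne R₃ →
      Cleanup s R s₃

  -- Operations (one whole operation per step).  A heap argument is
  -- either empty or given by its root r (a full node with no parent).

  InHeap : State → ℕ → ℕ → Set c
  InHeap s r u = IsRoot s r × (∃ λ k → ∃ λ rk → nodes s r ≡ just (node true k rk)) × Reach s r u

  data Op (s : State) : State → Set (c ⊔ ℓ₁ ⊔ ℓ₂) where
    -- make-heap, find-min, and meld with an empty heap: no change
    noop : Op s s
    insert-empty : ∀ k → Op s (create k 0 s)
    insert : ∀ {k r rk s'} → ∀ kn →
      IsRoot s r → nodes s r ≡ just (node true k rk) →
      LinkEither (create kn 0 s) (next s) r s' → Op s s'
    meld : ∀ {r₁ r₂ s'} → LinkEither s r₁ r₂ s' → Op s s'
    decrease-key-root : ∀ {u ku ru} k →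
      IsRoot s u → nodes s u ≡ just (node true ku ru) → k <ᵏ ku →
      Op s (setNode u (just (node true k ru)) s)
    decrease-key : ∀ {r u ku ru s'} k →
      InHeap s r u → u ≢ r → nodes s u ≡ just (node true ku ru) → k <ᵏ ku →
      LinkEither
        (addArc (next s , u)
          (create k (ru ∸ 2) (setNode u (just (node false ku ru)) s)))
        (next s) r s' →
      Op s s'
    delete-nonroot : ∀ {r u ku ru} →
      InHeap s r u → u ≢ r → nodes s u ≡ just (node true ku ru) →
      Op s (setNode u (just (node false ku ru)) s)
    -- delete(e,h) (and delete-min(h)) where e is held by the root u of h
    delete-root : ∀ {u ku ru s'} →
      IsRoot s u → nodes s u ≡ just (node true ku ru) →
      Cleanup (setNode u (just (node false ku ru)) s) (u ∷ []) s' →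
      Op s s'

  data Reachable : State → Set (c ⊔ ℓ₁ ⊔ ℓ₂) where
    start : Reachable initial
    step  : ∀ {s s'} → Reachable s → Op s s' → Reachable s'

-- Every arc is added by a link or by decrease-key.  A link adds one parent to a
-- full root, which had none; decrease-key adds one parent to a full node, which
-- had at most one, and makes it hollow at the same moment.  Destroying a node
-- only removes arcs, and no other step changes arcs or turns a hollow node full.
-- So "a full node has at most one parent, a hollow node at most two" is
-- invariant, and every new arc ends in a node that was full just before.  The
-- only other ingredient is freshness: arcs end in allocated names only, so a
-- newly created node starts without parents.
module Submission where

open import Defs
open import Data.Nat using (ℕ; _≤_; _<_; suc; z≤n; s≤s; _≟_; _≡ᵇ_; _∸_)
open import Data.Nat.Properties using (≡ᵇ⇒≡; ≡⇒≡ᵇ; ≤-refl; ≤-trans; <-irrefl; ≤-<-trans; <⇒≤; ≰⇒>; m<n⇒m<1+n; _≤?_)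
open import Data.Bool using (Bool; true; false; T)
open import Data.Unit using (tt)
open import Data.Empty using (⊥-elim)
open import Data.Maybe using (just; nothing)
open import Data.Maybe.Properties using (just-injective)
open import Data.Product using (_×_; _,_; proj₁; proj₂)
open import Data.Sum using (inj₁; inj₂)
open import Data.List using ([]; _∷_; length; map)
open import Data.List.Properties using (filter-accept; filter-reject; filter-none)
open import Data.List.Membership.Propositional using (_∈_)
open import Data.List.Membership.Propositional.Properties using (∈-filter⁻)
open import Data.List.Relation.Unary.All using (tabulate)
open import Data.List.Relation.Unary.Any using (here; there)
open import Data.List.Relation.Binary.Sublist.Propositional using (_⊆_)
open import Data.List.Relation.Binary.Sublist.Propositional.Properties using (map⁺; filter⁺; filter-⊆; length-mono-≤)
open import Relation.Binary.Bundles using (TotalOrder)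
open import Relation.Binary.PropositionalEquality using (_≡_; refl; sym; trans; cong; subst; _≢_)
open import Relation.Nullary using (¬_; yes; no)
open import Relation.Nullary.Decidable using (¬?)

maxParents : Bool → ℕ
maxParents true  = 1
maxParents false = 2

maxParents-cases : ∀ {n} b → n ≤ maxParents b → (b ≡ true → n ≤ 1) × (b ≡ false → n ≤ 2)
maxParents-cases true  n≤1 = (λ _ → n≤1) , λ ()
maxParents-cases false n≤2 = (λ ()) , λ _ → n≤2

module _ {c ℓ₁ ℓ₂} (O : TotalOrder c ℓ₁ ℓ₂) where
  open HollowHeap O

  nodes-setNode-self : ∀ v m s → nodes (setNode v m s) v ≡ m
  nodes-setNode-self v m s with v ≡ᵇ v in eq
  ... | true  = refl
  ... | false = ⊥-elim (subst T eq (≡⇒≡ᵇ v v refl))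

  nodes-setNode-other : ∀ {v w} m s → w ≢ v → nodes (setNode v m s) w ≡ nodes s w
  nodes-setNode-other {v} {w} m s w≢v with w ≡ᵇ v in eq
  ... | true  = ⊥-elim (w≢v (≡ᵇ⇒≡ w v (subst T (sym eq) tt)))
  ... | false = refl

  root-parents : ∀ {s l} → IsRoot s l → parents s l ≡ []
  root-parents {s} {l} root =
    cong (map proj₁) (filter-none (λ a → proj₂ a ≟ l) (tabulate not-into-l))
    where
    not-into-l : ∀ {a} → a ∈ arcs s → proj₂ a ≢ l
    not-into-l {p , _} a∈ refl = root p a∈

  parents-addArc-target : ∀ s p l → parents (addArc (p , l) s) l ≡ p ∷ parents s l
  parents-addArc-target s p l
    rewrite filter-accept (λ a → proj₂ a ≟ l) {p , l} {arcs s} refl = refl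

  parents-addArc-other : ∀ s p {w u} → w ≢ u → parents (addArc (p , w) s) u ≡ parents s u
  parents-addArc-other s p {w} {u} w≢u
    rewrite filter-reject (λ a → proj₂ a ≟ u) {p , w} {arcs s} w≢u = refl

  parents-destroy-⊆ : ∀ s x u → parents (destroy x s) u ⊆ parents s u
  parents-destroy-⊆ s x u =
    map⁺ proj₁ (filter⁺ into-u into-u (λ { refl p → p }) (filter-⊆ (λ a → ¬? (proj₁ a ≟ x)) (arcs s)))
    where
    into-u = λ (a : Arc) → proj₂ a ≟ u

  record WellFormed (s : State) : Set c where
    field
      unallocated-empty : ∀ w → next s ≤ w → nodes s w ≡ nothing
      arcs-allocated    : ∀ p w → (p , w) ∈ arcs s → w < next s
      parents-bounded   : ∀ u i → nodes s u ≡ just i → length (parents s u) ≤ maxParents (full i)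
  open WellFormed

  allocated : ∀ {s u i} → WellFormed s → nodes s u ≡ just i → u < next s
  allocated {s} {u} wf u↦i with next s ≤? u
  ... | no  u≮next = ≰⇒> u≮next
  ... | yes next≤u with trans (sym (unallocated-empty wf u next≤u)) u↦i
  ...   | ()

  -- Hollow or destroyed; u < next s excludes names not yet allocated, which may still become full.
  Retired : State → ℕ → Set c
  Retired s u = u < next s × (∀ i → nodes s u ≡ just i → full i ≡ false)

  full-not-retired : ∀ {s u k r} → nodes s u ≡ just (node true k r) → ¬ Retired s u
  full-not-retired u↦full (_ , hollow) with hollow _ u↦full
  ... | ()

  RetiredClosed : State → State → Set c
  RetiredClosed s s' =
    ∀ u → Retired s u → Retired s' u × (∀ p → (p , u) ∈ arcs s' → (p , u) ∈ arcs s)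

  Preserved : State → State → Set c
  Preserved s s' = WellFormed s → WellFormed s' × RetiredClosed s s'

  RetiredClosed-refl : ∀ {s} → RetiredClosed s s
  RetiredClosed-refl u ret = ret , λ _ p∈ → p∈

  RetiredClosed-trans : ∀ {s₁ s₂ s₃} → RetiredClosed s₁ s₂ → RetiredClosed s₂ s₃ → RetiredClosed s₁ s₃
  RetiredClosed-trans P Q u ret with P u ret
  ... | ret₂ , back₂ with Q u ret₂
  ...   | ret₃ , back₃ = ret₃ , λ p p∈ → back₂ p (back₃ p p∈)

  Preserved-refl : ∀ {s} → Preserved s s
  Preserved-refl wf = wf , RetiredClosed-refl

  Preserved-trans : ∀ {s₁ s₂ s₃} → Preserved s₁ s₂ → Preserved s₂ s₃ → Preserved s₁ s₃
  Preserved-trans P Q wf with P wf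
  ... | wf₂ , R₁₂ with Q wf₂
  ...   | wf₃ , R₂₃ = wf₃ , RetiredClosed-trans R₁₂ R₂₃

  setNode-preserved : ∀ {s v j} b k r → nodes s v ≡ just j →
    maxParents (full j) ≤ maxParents b → (full j ≡ false → b ≡ false) →
    Preserved s (setNode v (just (node b k r)) s)
  setNode-preserved {s} {v} {j} b k r v↦j bound-mono stays-hollow wf =
    record { unallocated-empty = unallocated ; arcs-allocated = arcs-allocated wf ; parents-bounded = bounded }
    , λ u ret → (proj₁ ret , still-hollow u ret) , λ _ p∈ → p∈
    where
    m = just (node b k r)
    unallocated : ∀ w → next s ≤ w → nodes (setNode v m s) w ≡ nothing
    unallocated w next≤w with w ≟ v
    ... | yes refl = ⊥-elim (<-irrefl refl (≤-<-trans next≤w (allocated wf v↦j)))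
    ... | no  w≢v  = trans (nodes-setNode-other m s w≢v) (unallocated-empty wf w next≤w)
    bounded : ∀ u i → nodes (setNode v m s) u ≡ just i → length (parents s u) ≤ maxParents (full i)
    bounded u i u↦i with u ≟ v
    ... | no  u≢v  = parents-bounded wf u i (trans (sym (nodes-setNode-other m s u≢v)) u↦i)
    ... | yes refl with just-injective (trans (sym u↦i) (nodes-setNode-self v m s))
    ...   | refl = ≤-trans (parents-bounded wf v j v↦j) bound-mono
    still-hollow : ∀ u → Retired s u → ∀ i → nodes (setNode v m s) u ≡ just i → full i ≡ false
    still-hollow u (_ , hollow) i u↦i with u ≟ v
    ... | no  u≢v  = hollow i (trans (sym (nodes-setNode-other m s u≢v)) u↦i)
    ... | yes refl with just-injective (trans (sym u↦i) (nodes-setNode-self v m s))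
    ...   | refl = stays-hollow (hollow j v↦j)

  create-preserved : ∀ {s} k r → Preserved s (create k r s)
  create-preserved {s} k r wf =
    record { unallocated-empty = unallocated ; arcs-allocated = allocated′ ; parents-bounded = bounded }
    , λ u ret → (m<n⇒m<1+n (proj₁ ret) , still-hollow u ret) , λ _ p∈ → p∈
    where
    m = just (node true k r)
    fresh = next s
    unallocated : ∀ w → suc fresh ≤ w → nodes (setNode fresh m s) w ≡ nothing
    unallocated w fresh<w with w ≟ fresh
    ... | yes refl = ⊥-elim (<-irrefl refl fresh<w)
    ... | no w≢fresh = trans (nodes-setNode-other m s w≢fresh) (unallocated-empty wf w (<⇒≤ fresh<w))
    allocated′ : ∀ p w → (p , w) ∈ arcs s → w < suc fresh
    allocated′ p w p∈ = m<n⇒m<1+n (arcs-allocated wf p w p∈)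
    fresh-root : IsRoot s fresh
    fresh-root p p∈ = <-irrefl refl (arcs-allocated wf p fresh p∈)
    bounded : ∀ u i → nodes (setNode fresh m s) u ≡ just i → length (parents s u) ≤ maxParents (full i)
    bounded u i u↦i with u ≟ fresh
    ... | no u≢fresh = parents-bounded wf u i (trans (sym (nodes-setNode-other m s u≢fresh)) u↦i)
    ... | yes refl rewrite root-parents {s} fresh-root = z≤n
    still-hollow : ∀ u → Retired s u → ∀ i → nodes (setNode fresh m s) u ≡ just i → full i ≡ false
    still-hollow u (u<fresh , hollow) i u↦i with u ≟ fresh
    ... | no u≢fresh = hollow i (trans (sym (nodes-setNode-other m s u≢fresh)) u↦i)
    ... | yes refl = ⊥-elim (<-irrefl refl u<fresh)

  destroy-preserved : ∀ {s} x → Preserved s (destroy x s)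
  destroy-preserved {s} x wf =
    record { unallocated-empty = unallocated ; arcs-allocated = allocated′ ; parents-bounded = bounded }
    , λ u ret → (proj₁ ret , still-hollow u ret) , λ _ p∈ → kept p∈
    where
    kept : ∀ {a} → a ∈ arcs (destroy x s) → a ∈ arcs s
    kept a∈ = proj₁ (∈-filter⁻ (λ a → ¬? (proj₁ a ≟ x)) a∈)
    unallocated : ∀ w → next s ≤ w → nodes (setNode x nothing s) w ≡ nothing
    unallocated w next≤w with w ≟ x
    ... | yes refl = nodes-setNode-self x nothing s
    ... | no  w≢x  = trans (nodes-setNode-other nothing s w≢x) (unallocated-empty wf w next≤w)
    allocated′ : ∀ p w → (p , w) ∈ arcs (destroy x s) → w < next s
    allocated′ p w p∈ = arcs-allocated wf p w (kept p∈)
    bounded : ∀ u i → nodes (setNode x nothing s) u ≡ just i →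
              length (parents (destroy x s) u) ≤ maxParents (full i)
    bounded u i u↦i with u ≟ x
    ... | yes refl with trans (sym u↦i) (nodes-setNode-self x nothing s)
    ...   | ()
    bounded u i u↦i | no u≢x =
      ≤-trans (length-mono-≤ (parents-destroy-⊆ s x u))
              (parents-bounded wf u i (trans (sym (nodes-setNode-other nothing s u≢x)) u↦i))
    still-hollow : ∀ u → Retired s u → ∀ i → nodes (setNode x nothing s) u ≡ just i → full i ≡ false
    still-hollow u (_ , hollow) i u↦i with u ≟ x
    ... | no  u≢x  = hollow i (trans (sym (nodes-setNode-other nothing s u≢x)) u↦i)
    ... | yes refl with trans (sym u↦i) (nodes-setNode-self x nothing s)
    ...   | ()

  addArc-preserved : ∀ {s s' w l j} → Preserved s s' → ¬ Retired s l →
    nodes s' l ≡ just j → suc (length (parents s' l)) ≤ maxParents (full j) →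
    Preserved s (addArc (w , l) s')
  addArc-preserved {s} {s'} {w} {l} {j} P l-active l↦j room wf with P wf
  ... | wf' , R =
    record { unallocated-empty = unallocated-empty wf' ; arcs-allocated = allocated′ ; parents-bounded = bounded }
    , λ u ret → proj₁ (R u ret) , back u ret
    where
    allocated′ : ∀ p v → (p , v) ∈ ((w , l) ∷ arcs s') → v < next s'
    allocated′ p v (here refl) = allocated wf' l↦j
    allocated′ p v (there p∈)  = arcs-allocated wf' p v p∈
    bounded : ∀ u i → nodes s' u ≡ just i → length (parents (addArc (w , l) s') u) ≤ maxParents (full i)
    bounded u i u↦i with l ≟ u
    ... | no l≢u rewrite parents-addArc-other s' w l≢u = parents-bounded wf' u i u↦i
    ... | yes refl with just-injective (trans (sym u↦i) l↦j)
    ...   | refl rewrite parents-addArc-target s' w l = room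
    back : ∀ u → Retired s u → ∀ p → (p , u) ∈ ((w , l) ∷ arcs s') → (p , u) ∈ arcs s
    back u ret p (here refl) = ⊥-elim (l-active ret)
    back u ret p (there p∈)  = proj₂ (R u ret) p p∈

  root-has-room : ∀ {s l} → IsRoot s l → suc (length (parents s l)) ≤ maxParents true
  root-has-room {s} root rewrite root-parents {s} root = ≤-refl

  unrankedLink-preserved : ∀ {s w l s'} → UnrankedLink s w l s' → Preserved s s'
  unrankedLink-preserved {s} (ulink _ _ l↦l _ l-root _) =
    addArc-preserved Preserved-refl (full-not-retired {s} l↦l) l↦l (root-has-room {s} l-root)

  rankedLink-preserved : ∀ {s w l s'} → RankedLink s w l s' → Preserved s s'
  rankedLink-preserved {s} (rlink {kw} {r = r} w≢l w↦w l↦l _ l-root _) =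
    addArc-preserved (setNode-preserved true kw (suc r) w↦w ≤-refl (λ ()))
                     (full-not-retired {s} l↦l)
                     (trans (nodes-setNode-other _ s (λ l≡w → w≢l (sym l≡w))) l↦l)
                     (root-has-room {s} l-root)

  linkEither-preserved : ∀ {s a b s'} → LinkEither s a b s' → Preserved s s'
  linkEither-preserved (inj₁ link) = unrankedLink-preserved link
  linkEither-preserved (inj₂ link) = unrankedLink-preserved link

  destroyPhase-preserved : ∀ {s R s' R'} → DestroyPhase s R s' R' → Preserved s s'
  destroyPhase-preserved done = Preserved-refl
  destroyPhase-preserved (destroy-step {x = x} _ _ rest) =
    Preserved-trans (destroy-preserved x) (destroyPhase-preserved rest)

  rankedPhase-preserved : ∀ {s R s' R'} → RankedPhase s R s' R' → Preserved s s'
  rankedPhase-preserved done = Preserved-refl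
  rankedPhase-preserved (rank-step _ link rest) =
    Preserved-trans (rankedLink-preserved link) (rankedPhase-preserved rest)

  unrankedPhase-preserved : ∀ {s R s' R'} → UnrankedPhase s R s' R' → Preserved s s'
  unrankedPhase-preserved done = Preserved-refl
  unrankedPhase-preserved (unrank-step _ link rest) =
    Preserved-trans (unrankedLink-preserved link) (unrankedPhase-preserved rest)

  cleanup-preserved : ∀ {s R s'} → Cleanup s R s' → Preserved s s'
  cleanup-preserved (cleanup destroys _ ranked _ unranked _) =
    Preserved-trans (destroyPhase-preserved destroys)
      (Preserved-trans (rankedPhase-preserved ranked) (unrankedPhase-preserved unranked))

  hollowing-preserved : ∀ {s u k r} → nodes s u ≡ just (node true k r) →
    Preserved s (setNode u (just (node false k r)) s)
  hollowing-preserved u↦u = setNode-preserved false _ _ u↦u (s≤s z≤n) (λ _ → refl)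

  -- The new arc ends in u, already hollow, so its admissibility rests on u having been full before the step.
  moveItem-preserved : ∀ {s u ku ru} k → nodes s u ≡ just (node true ku ru) →
    Preserved s (addArc (next s , u) (create k (ru ∸ 2) (setNode u (just (node false ku ru)) s)))
  moveItem-preserved {s} {u} {ku} {ru} k u↦u wf =
    addArc-preserved (Preserved-trans (hollowing-preserved u↦u) (create-preserved k (ru ∸ 2)))
                     (full-not-retired {s} u↦u) u↦hollow
                     (s≤s (parents-bounded wf u _ u↦u)) wf
    where
    hollowed = setNode u (just (node false ku ru)) s
    u↦hollow : nodes (create k (ru ∸ 2) hollowed) u ≡ just (node false ku ru)
    u↦hollow = trans (nodes-setNode-other _ hollowed (λ u≡next → <-irrefl u≡next (allocated wf u↦u)))
                     (nodes-setNode-self u _ s)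

  op-preserved : ∀ {s s'} → Op s s' → Preserved s s'
  op-preserved noop = Preserved-refl
  op-preserved (insert-empty k) = create-preserved k 0
  op-preserved (insert k _ _ link) = Preserved-trans (create-preserved k 0) (linkEither-preserved link)
  op-preserved (meld link) = linkEither-preserved link
  op-preserved (decrease-key-root k _ u↦u _) = setNode-preserved true k _ u↦u ≤-refl (λ ())
  op-preserved (decrease-key k _ _ u↦u _ link) =
    Preserved-trans (moveItem-preserved k u↦u) (linkEither-preserved link)
  op-preserved (delete-nonroot _ _ u↦u) = hollowing-preserved u↦u
  op-preserved (delete-root _ u↦u clean) =
    Preserved-trans (hollowing-preserved u↦u) (cleanup-preserved clean)

  reachable-wellFormed : ∀ {s} → Reachable s → WellFormed s
  reachable-wellFormed start =
    record { unallocated-empty = λ _ _ → refl ; arcs-allocated = λ _ _ () ; parents-bounded = λ _ _ () }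
  reachable-wellFormed (step r op) = proj₁ (op-preserved op (reachable-wellFormed r))

  reachable-parents-bounded : ∀ {s u i} → Reachable s → nodes s u ≡ just i →
    length (parents s u) ≤ maxParents (full i)
  reachable-parents-bounded r = parents-bounded (reachable-wellFormed r) _ _

  hollow-gains-no-parent : ∀ {s s' u i p} → Reachable s → Op s s' →
    nodes s u ≡ just i → full i ≡ false → (p , u) ∈ arcs s' → (p , u) ∈ arcs s
  hollow-gains-no-parent {s} {u = u} {p = p} r op u↦i hollow p∈ =
    proj₂ (proj₂ (op-preserved op wf) _ (allocated wf u↦i , retired)) p p∈
    where
    wf = reachable-wellFormed r
    retired : ∀ j → nodes s u ≡ just j → full j ≡ false
    retired j u↦j = trans (cong full (just-injective (trans (sym u↦j) u↦i))) hollow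

lemma4p2 : ∀ {c ℓ₁ ℓ₂} (O : TotalOrder c ℓ₁ ℓ₂) →
    let open HollowHeap O in
    (∀ s → Reachable s → ∀ u i → nodes s u ≡ just i →
       (full i ≡ true → length (parents s u) ≤ 1) ×
       (full i ≡ false → length (parents s u) ≤ 2))
    ×
    (∀ s s' → Reachable s → Op s s' → ∀ u i p →
       nodes s u ≡ just i → full i ≡ false →
       (p , u) ∈ arcs s' → (p , u) ∈ arcs s)
lemma4p2 O = let open HollowHeap O in
  (λ s r u i u↦i → maxParents-cases (full i) (reachable-parents-bounded O r u↦i)) ,
  λ s s' r op u i p → hollow-gains-no-parent O r op
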